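{- Let $\mathcal{C}$ be a minimum-transversal-covered clutter on a finite set $E$ that satisfies the integral blocking condition and is non-separable. Then $\tilde{\mathcal{C}}$ is non-separable.
   Context: A clutter on $E$ is a family of subsets none containing another (members: hyperedges). A transversal is an inclusion-minimal subset meeting all hyperedges; $\mathrm{bn}$ the minimum transversal size; $\mathrm{minb}$ the minimum-size transversals; minimum-transversal-covered means $\bigcup\mathrm{minb}(\mathcal{C})=E$. A fractional packing is $y:\mathcal{C}\to\mathbb{R}_{\ge0}$ with $\sum_{H\ni a}y(H)\le1$ for all $a$; $\mathrm{fpn}$ the maximum of $\sum_Hy(H)$; integral blocking condition: $\mathrm{fpn}=\mathrm{bn}$. $\tilde{\mathcal{C}}=\{H\in\mathcal{C}:|H\cap B|=1\ \forall B\in\mathrm{minb}(\mathcal{C})\}$. With $\mathcal{C}[F]=\{X\in\mathcal{C}:X\subseteq F\}$, a clutter $\mathcal{C}$ on $E$ is separable if some partition $\{E_1,E_2\}$ of $E$ into nonempty parts has $\mathrm{bn}(\mathcal{C})=\mathrm{bn}(\mathcal{C}[E_1])+\mathrm{bn}(\mathcal{C}[E_2])$; otherwise non-separable.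
   Formalization: The fractional packings $y$ in the integral blocking condition take values in the nonnegative rationals rather than in $\mathbb{R}_{\ge0}$. -}

module Defs where

open import Data.Nat as ℕ using (ℕ; _+_)
open import Data.Fin using (Fin)
open import Data.Fin.Subset using (Subset; _∈_; _∉_; _⊆_; _∩_; ∣_∣; Nonempty; Empty; _∪_; ⊤)
open import Data.Fin.Subset.Properties using (_∈?_; _⊆?_)
open import Data.List using (List; filter; map; foldr)
open import Data.List.Membership.Propositional renaming (_∈_ to _∈ᴸ_)
open import Data.List.Relation.Unary.Unique.Propositional using (Unique)
open import Data.Integer using (+_)
open import Data.Rational as ℚ using (ℚ; 0ℚ; 1ℚ)
open import Data.Product using (Σ; ∃; _×_; _,_)
open import Relation.Binary.PropositionalEquality using (_≡_; _≢_)
open import Relation.Nullary using (¬_)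

-- Ground set E = Fin n; subsets of E are `Subset n`.
-- A family of subsets of E is a list of subsets (membership is what matters).
Family : ℕ → Set
Family n = List (Subset n)

IsClutter : ∀ {n} → Family n → Set
IsClutter {n} C = Unique C ×
  (∀ (H H′ : Subset n) → H ∈ᴸ C → H′ ∈ᴸ C → H ⊆ H′ → H ≡ H′)

IsCover : ∀ {n} → Family n → Subset n → Set
IsCover C B = ∀ H → H ∈ᴸ C → Nonempty (H ∩ B)

IsTransversal : ∀ {n} → Family n → Subset n → Set
IsTransversal {n} C B = IsCover C B × (∀ (B′ : Subset n) → B′ ⊆ B → IsCover C B′ → B′ ≡ B)

IsBn : ∀ {n} → Family n → ℕ → Set
IsBn {n} C k = (Σ (Subset n) λ B → IsTransversal C B × ∣ B ∣ ≡ k)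
             × (∀ (B : Subset n) → IsTransversal C B → k ℕ.≤ ∣ B ∣)

IsMinb : ∀ {n} → Family n → Subset n → Set
IsMinb {n} C B = IsTransversal C B × (∀ (B′ : Subset n) → IsTransversal C B′ → ∣ B ∣ ℕ.≤ ∣ B′ ∣)

MinTransversalCovered : ∀ {n} → Family n → Set
MinTransversalCovered {n} C = ∀ (a : Fin n) → Σ (Subset n) λ B → IsMinb C B × a ∈ B

sumℚ : List ℚ → ℚ
sumℚ = foldr ℚ._+_ 0ℚ

containing : ∀ {n} → Fin n → Family n → Family n
containing a C = filter (a ∈?_) C

IsFracPacking : ∀ {n} → Family n → (Subset n → ℚ) → Set
IsFracPacking {n} C y = (∀ H → H ∈ᴸ C → 0ℚ ℚ.≤ y H)
                      × (∀ (a : Fin n) → sumℚ (map y (containing a C)) ℚ.≤ 1ℚ)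

packingValue : ∀ {n} → Family n → (Subset n → ℚ) → ℚ
packingValue C y = sumℚ (map y C)

IntegralBlocking : ∀ {n} → Family n → Set
IntegralBlocking {n} C = Σ ℕ λ k → IsBn C k
  × (Σ (Subset n → ℚ) λ y → IsFracPacking C y × packingValue C y ≡ (+ k ℚ./ 1))
  × (∀ (y : Subset n → ℚ) → IsFracPacking C y → packingValue C y ℚ.≤ (+ k ℚ./ 1))

restrict : ∀ {n} → Family n → Subset n → Family n
restrict C F = filter (_⊆? F) C

IsBipartition : ∀ {n} → Subset n → Subset n → Set
IsBipartition E₁ E₂ = Nonempty E₁ × Nonempty E₂ × Empty (E₁ ∩ E₂) × E₁ ∪ E₂ ≡ ⊤

Separable : ∀ {n} → Family n → Set
Separable {n} C = Σ (Subset n) λ E₁ → Σ (Subset n) λ E₂ → IsBipartition E₁ E₂ ×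
  Σ ℕ λ k → Σ ℕ λ k₁ → Σ ℕ λ k₂ →
    IsBn C k × IsBn (restrict C E₁) k₁ × IsBn (restrict C E₂) k₂ × k ≡ k₁ + k₂

NonSeparable : ∀ {n} → Family n → Set
NonSeparable C = ¬ Separable C

-- D represents C̃ = {H ∈ C : |H ∩ B| = 1 for all B ∈ minb(C)} (as a duplicate-free list).
IsTilde : ∀ {n} → Family n → Family n → Set
IsTilde {n} C D = Unique D × (∀ (H : Subset n) →
  (H ∈ᴸ D → H ∈ᴸ C × (∀ B → IsMinb C B → ∣ H ∩ B ∣ ≡ 1))
  × (H ∈ᴸ C → (∀ B → IsMinb C B → ∣ H ∩ B ∣ ≡ 1) → H ∈ᴸ D))

-- Fix a fractional packing y of value bn(C). Counting incidences gives
-- Σ_H |H ∩ S| y(H) ≤ |S| for every S, and y(H) ≤ |H ∩ B| y(H) whenever B meets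
-- H. For a minimum transversal B the chain bn(C) = Σ_H y(H) ≤ Σ_H |H ∩ B| y(H)
-- ≤ |B| = bn(C) is tight, so every hyperedge in the support of y meets every
-- minimum transversal exactly once: the support lies in C̃. The same chain for a
-- cover of C̃ shows that it has size at least bn(C). Now if {E₁, E₂} separates
-- C̃, a minimum transversal B of C splits into B ∩ E₁ and B ∩ E₂, which cover
-- C[Eᵢ] ⊇ C̃[Eᵢ]. Comparing sizes forces |B ∩ Eᵢ| = bn(C̃[Eᵢ]), and since every
-- cover of C[Eᵢ] covers C̃[Eᵢ], also |B ∩ Eᵢ| = bn(C[Eᵢ]): the same partition
-- separates C.
module Submission where

open import Defs
open import Data.Nat using (ℕ; zero; suc; _+_; _≤_; _<_; s≤s; z≤n)

open import Algebra.Bundles using (CommutativeMonoid)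
open import Data.Bool using (true; false)
open import Data.Fin using (Fin; zero; suc)
import Data.Fin.Properties as FinP
open import Data.Fin.Subset
  using (Subset; _∈_; _⊆_; _∩_; ∁; ∣_∣; Nonempty; _-_; ⁅_⁆)
open import Data.Fin.Subset.Properties
  using ( _∈?_; _⊆?_; nonempty?; drop-there; x∈p∩q⁺; x∈p∩q⁻; x∈p∪q⁻; ∈⊤
        ; ⊆-antisym; p⊆q⇒∣p∣≤∣q∣; p⊂q⇒∣p∣<∣q∣; x∈p⇒∣p-x∣<∣p∣
        ; x∈p∧x∉q⇒x∈p─q; p─q⊆p; x∈⁅y⁆⇒x≡y; ∣⁅x⁆∣≡1; x∈∁p⇒x∉p; x∉p⇒x∈∁p )
open import Data.Integer as ℤ using (+_)
import Data.Integer.Properties as ℤP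
open import Data.List using (List; []; _∷_; map; filter)
open import Data.List.Properties using (map-cong; filter-≐)
open import Data.List.Membership.Propositional renaming (_∈_ to _∈ᴸ_)
open import Data.List.Membership.Propositional.Properties using (∈-filter⁻)
open import Data.List.Relation.Binary.Subset.Propositional renaming (_⊆_ to _⊆ᴸ_)
open import Data.List.Relation.Binary.Subset.Propositional.Properties using (filter⁺′)
import Data.List.Relation.Unary.All as All
open import Data.List.Relation.Unary.Any using (here; there)
open import Data.Nat.Induction using (<-wellFounded)
import Data.Nat.Properties as ℕP
import Data.Nat.Coprimality as Coprimality
open import Data.Product using (∃; _×_; _,_; proj₁; proj₂)
open import Data.Rational as ℚ using (ℚ; 0ℚ; 1ℚ; mkℚ)
import Data.Rational.Properties as ℚP
open import Data.Vec as Vec using (_∷_; []; tail)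
open import Data.Sum using (inj₁; inj₂)
open import Function using (_∘_; id)
open import Induction.WellFounded using (Acc; acc)
open import Relation.Binary.PropositionalEquality
open import Relation.Nullary using (¬_; Dec; yes; no; contradiction)
open import Relation.Nullary.Decidable using (_×-dec_)

open import Algebra.Properties.Monoid.Mult ℚP.+-0-monoid using () renaming (_×_ to _·_)
open import Algebra.Properties.CommutativeSemigroup
  (CommutativeMonoid.commutativeSemigroup ℚP.+-0-commutativeMonoid)
  using (interchange; x∙yz≈y∙xz)

fromℕ : ℕ → ℚ
fromℕ m = + m ℚ./ 1

-- `+ m / 1` is normalised through a gcd, which does not compute for a variable m.
fromℕ≡mkℚ : ∀ m → fromℕ m ≡ mkℚ (+ m) 0 (Coprimality.sym (Coprimality.1-coprimeTo m))
fromℕ≡mkℚ m = ℚP.↥p/↧p≡p (mkℚ (+ m) 0 _)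

fromℕ-suc : ∀ m → fromℕ (suc m) ≡ 1ℚ ℚ.+ fromℕ m
fromℕ-suc m rewrite fromℕ≡mkℚ m =
  sym (cong (λ z → (+ 1 ℤ.+ z) ℚ./ 1) (ℤP.*-identityʳ (+ m)))

fromℕ-cancel-≤ : ∀ {a b} → fromℕ a ℚ.≤ fromℕ b → a ≤ b
fromℕ-cancel-≤ {a} {b} p rewrite fromℕ≡mkℚ a | fromℕ≡mkℚ b =
  ℤP.drop‿+≤+ (subst₂ ℤ._≤_ (ℤP.*-identityʳ (+ a)) (ℤP.*-identityʳ (+ b)) (ℚP.drop-*≤* p))

<⇒≱ : ∀ {p q} → p ℚ.< q → ¬ q ℚ.≤ p
<⇒≱ p<q q≤p = ℚP.<-irrefl refl (ℚP.<-≤-trans p<q q≤p)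

0≤m·q : ∀ m {q} → 0ℚ ℚ.≤ q → 0ℚ ℚ.≤ m · q
0≤m·q zero    _   = ℚP.≤-refl
0≤m·q (suc m) 0≤q = ℚP.+-mono-≤ 0≤q (0≤m·q m 0≤q)

q≤m·q : ∀ {m q} → 1 ≤ m → 0ℚ ℚ.≤ q → q ℚ.≤ m · q
q≤m·q {suc m} {q} _ 0≤q =
  subst (ℚ._≤ q ℚ.+ m · q) (ℚP.+-identityʳ q) (ℚP.+-monoʳ-≤ q (0≤m·q m 0≤q))

m·q≤q⇒m≡1 : ∀ {m q} → 1 ≤ m → 0ℚ ℚ.< q → m · q ℚ.≤ q → m ≡ 1
m·q≤q⇒m≡1 {1}           _ _   _         = refl
m·q≤q⇒m≡1 {suc (suc m)} {q} _ 0<q 2+m·q≤q = contradiction 2+m·q≤q (<⇒≱ q<2+m·q)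
  where
  0<1+m·q : 0ℚ ℚ.< suc m · q
  0<1+m·q = ℚP.<-≤-trans 0<q (q≤m·q {suc m} (s≤s z≤n) (ℚP.<⇒≤ 0<q))
  q<2+m·q : q ℚ.< q ℚ.+ suc m · q
  q<2+m·q = subst (ℚ._< q ℚ.+ suc m · q) (ℚP.+-identityʳ q) (ℚP.+-monoʳ-< q 0<1+m·q)

module _ {A : Set} where

  sum-map-0 : ∀ {f : A → ℚ} xs → (∀ x → f x ≡ 0ℚ) → sumℚ (map f xs) ≡ 0ℚ
  sum-map-0 []       _    = refl
  sum-map-0 (x ∷ xs) f≡0 rewrite f≡0 x | sum-map-0 xs f≡0 = refl

  sum-mono-≤ : ∀ {f g : A → ℚ} xs → (∀ {x} → x ∈ᴸ xs → f x ℚ.≤ g x) →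
               sumℚ (map f xs) ℚ.≤ sumℚ (map g xs)
  sum-mono-≤ []       _   = ℚP.≤-refl
  sum-mono-≤ (x ∷ xs) f≤g = ℚP.+-mono-≤ (f≤g (here refl)) (sum-mono-≤ xs (f≤g ∘ there))

  sum-mono-< : ∀ {f g : A → ℚ} {x} xs → (∀ {x} → x ∈ᴸ xs → f x ℚ.≤ g x) →
               x ∈ᴸ xs → f x ℚ.< g x → sumℚ (map f xs) ℚ.< sumℚ (map g xs)
  sum-mono-< (_ ∷ xs) f≤g (here refl) fx<gx =
    ℚP.+-mono-<-≤ fx<gx (sum-mono-≤ xs (f≤g ∘ there))
  sum-mono-< (_ ∷ xs) f≤g (there x∈xs) fx<gx =
    ℚP.+-mono-≤-< (f≤g (here refl)) (sum-mono-< xs (f≤g ∘ there) x∈xs fx<gx)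

  sum-≤-tight : ∀ {f g : A → ℚ} {x} xs → (∀ {x} → x ∈ᴸ xs → f x ℚ.≤ g x) →
                sumℚ (map g xs) ℚ.≤ sumℚ (map f xs) → x ∈ᴸ xs → g x ℚ.≤ f x
  sum-≤-tight {f} {g} {x} xs f≤g Σg≤Σf x∈xs with g x ℚP.≤? f x
  ... | yes gx≤fx = gx≤fx
  ... | no  gx≰fx = contradiction Σg≤Σf (<⇒≱ (sum-mono-< xs f≤g x∈xs (ℚP.≰⇒> gx≰fx)))

∣p∩[]∣≡0 : (p : Subset 0) → ∣ p ∩ [] ∣ ≡ 0
∣p∩[]∣≡0 [] = refl

∣p∩false∷q∣ : ∀ {n} (p : Subset (suc n)) q → ∣ p ∩ (false ∷ q) ∣ ≡ ∣ tail p ∩ q ∣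
∣p∩false∷q∣ (true  ∷ _) _ = refl
∣p∩false∷q∣ (false ∷ _) _ = refl

module _ {A : Set} where

  load : ∀ {n} → (A → Subset n) → (A → ℚ) → List A → Fin n → ℚ
  load f w xs a = sumℚ (map w (filter (λ x → a ∈? f x) xs))

  load-suc : ∀ {n} (f : A → Subset (suc n)) w xs a →
             load f w xs (suc a) ≡ load (tail ∘ f) w xs a
  load-suc f w xs a = cong (sumℚ ∘ map w)
    (filter-≐ _ _ ((λ {x} → suc∈⇒∈tail (f x)) , (λ {x} → ∈tail⇒suc∈ (f x))) xs)
    where
    suc∈⇒∈tail : (p : Subset (suc _)) → suc a ∈ p → a ∈ tail p
    suc∈⇒∈tail (_ ∷ _) = drop-there
    ∈tail⇒suc∈ : (p : Subset (suc _)) → a ∈ tail p → suc a ∈ p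
    ∈tail⇒suc∈ (_ ∷ _) = Vec.there

  sum-∩-true∷ : ∀ {n} (f : A → Subset (suc n)) w xs (S : Subset n) →
                sumℚ (map (λ x → ∣ f x ∩ (true ∷ S) ∣ · w x) xs)
                ≡ load f w xs zero ℚ.+ sumℚ (map (λ x → ∣ tail (f x) ∩ S ∣ · w x) xs)
  sum-∩-true∷ f w []       S = refl
  sum-∩-true∷ f w (x ∷ xs) S with f x
  ... | true  ∷ p = trans (cong (w x ℚ.+ ∣ p ∩ S ∣ · w x ℚ.+_) (sum-∩-true∷ f w xs S))
                          (interchange (w x) (∣ p ∩ S ∣ · w x) _ _)
  ... | false ∷ p = trans (cong (∣ p ∩ S ∣ · w x ℚ.+_) (sum-∩-true∷ f w xs S))
                          (x∙yz≈y∙xz (∣ p ∩ S ∣ · w x) (load f w xs zero) _)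

  tail-load≤1 : ∀ {n} (f : A → Subset (suc n)) w xs {s} {S : Subset n} →
                (∀ {a} → a ∈ s ∷ S → load f w xs a ℚ.≤ 1ℚ) →
                ∀ {a} → a ∈ S → load (tail ∘ f) w xs a ℚ.≤ 1ℚ
  tail-load≤1 f w xs load≤1 {a} a∈S =
    subst (ℚ._≤ 1ℚ) (load-suc f w xs a) (load≤1 (Vec.there a∈S))

  -- The labelling f is arbitrary so that the induction on n can pass to tails.
  double-counting : ∀ {n} (f : A → Subset n) w xs (S : Subset n) →
                    (∀ {a} → a ∈ S → load f w xs a ℚ.≤ 1ℚ) →
                    sumℚ (map (λ x → ∣ f x ∩ S ∣ · w x) xs) ℚ.≤ fromℕ ∣ S ∣
  double-counting f w xs [] _ =
    ℚP.≤-reflexive (sum-map-0 xs (λ x → cong (_· w x) (∣p∩[]∣≡0 (f x))))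
  double-counting f w xs (false ∷ S) load≤1 = begin
    sumℚ (map (λ x → ∣ f x ∩ (false ∷ S) ∣ · w x) xs)
      ≡⟨ cong sumℚ (map-cong (λ x → cong (_· w x) (∣p∩false∷q∣ (f x) S)) xs) ⟩
    sumℚ (map (λ x → ∣ tail (f x) ∩ S ∣ · w x) xs)
      ≤⟨ double-counting (tail ∘ f) w xs S (tail-load≤1 f w xs load≤1) ⟩
    fromℕ ∣ S ∣ ∎
    where open ℚP.≤-Reasoning
  double-counting f w xs (true ∷ S) load≤1 = begin
    sumℚ (map (λ x → ∣ f x ∩ (true ∷ S) ∣ · w x) xs)
      ≡⟨ sum-∩-true∷ f w xs S ⟩
    load f w xs zero ℚ.+ sumℚ (map (λ x → ∣ tail (f x) ∩ S ∣ · w x) xs)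
      ≤⟨ ℚP.+-mono-≤ (load≤1 Vec.here)
                     (double-counting (tail ∘ f) w xs S (tail-load≤1 f w xs load≤1)) ⟩
    1ℚ ℚ.+ fromℕ ∣ S ∣
      ≡⟨ fromℕ-suc ∣ S ∣ ⟨
    fromℕ (suc ∣ S ∣) ∎
    where open ℚP.≤-Reasoning

nonempty⇒1≤∣p∣ : ∀ {n} {p : Subset n} → Nonempty p → 1 ≤ ∣ p ∣
nonempty⇒1≤∣p∣ {p = p} (x , x∈p) = subst (_≤ ∣ p ∣) (∣⁅x⁆∣≡1 x)
  (p⊆q⇒∣p∣≤∣q∣ (λ y∈⁅x⁆ → subst (_∈ p) (sym (x∈⁅y⁆⇒x≡y _ y∈⁅x⁆)) x∈p))

p⊆q∧∣q∣≤∣p∣⇒p≡q : ∀ {n} {p q : Subset n} → p ⊆ q → ∣ q ∣ ≤ ∣ p ∣ → p ≡ q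
p⊆q∧∣q∣≤∣p∣⇒p≡q {p = p} p⊆q ∣q∣≤∣p∣ = ⊆-antisym p⊆q q⊆p
  where
  q⊆p : _ ⊆ p
  q⊆p {x} x∈q with x ∈? p
  ... | yes x∈p = x∈p
  ... | no  x∉p = contradiction ∣q∣≤∣p∣ (ℕP.<⇒≱ (p⊂q⇒∣p∣<∣q∣ (p⊆q , x , x∈q , x∉p)))

∣p∩q∣+∣p∩∁q∣≡∣p∣ : ∀ {n} (p q : Subset n) → ∣ p ∩ q ∣ + ∣ p ∩ ∁ q ∣ ≡ ∣ p ∣
∣p∩q∣+∣p∩∁q∣≡∣p∣ []            []            = refl
∣p∩q∣+∣p∩∁q∣≡∣p∣ (true  ∷ p) (true  ∷ q) = cong suc (∣p∩q∣+∣p∩∁q∣≡∣p∣ p q)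
∣p∩q∣+∣p∩∁q∣≡∣p∣ (true  ∷ p) (false ∷ q) =
  trans (ℕP.+-suc _ _) (cong suc (∣p∩q∣+∣p∩∁q∣≡∣p∣ p q))
∣p∩q∣+∣p∩∁q∣≡∣p∣ (false ∷ p) (true  ∷ q) = ∣p∩q∣+∣p∩∁q∣≡∣p∣ p q
∣p∩q∣+∣p∩∁q∣≡∣p∣ (false ∷ p) (false ∷ q) = ∣p∩q∣+∣p∩∁q∣≡∣p∣ p q

bipartition⇒≡∁ : ∀ {n} {E₁ E₂ : Subset n} → IsBipartition E₁ E₂ → E₂ ≡ ∁ E₁
bipartition⇒≡∁ {E₁ = E₁} {E₂} (_ , _ , disjoint , E₁∪E₂≡⊤) = ⊆-antisym E₂⊆∁E₁ ∁E₁⊆E₂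
  where
  E₂⊆∁E₁ : E₂ ⊆ ∁ E₁
  E₂⊆∁E₁ x∈E₂ = x∉p⇒x∈∁p (λ x∈E₁ → disjoint (_ , x∈p∩q⁺ (x∈E₁ , x∈E₂)))
  ∁E₁⊆E₂ : ∁ E₁ ⊆ E₂
  ∁E₁⊆E₂ {x} x∈∁E₁ with x∈p∪q⁻ E₁ E₂ (subst (x ∈_) (sym E₁∪E₂≡⊤) ∈⊤)
  ... | inj₁ x∈E₁ = contradiction x∈E₁ (x∈∁p⇒x∉p x∈∁E₁)
  ... | inj₂ x∈E₂ = x∈E₂

module _ {n : ℕ} where

  IsCover-monoʳ : ∀ {F : Family n} {P Q} → P ⊆ Q → IsCover F P → IsCover F Q
  IsCover-monoʳ P⊆Q covP H H∈F with covP H H∈F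
  ... | x , x∈H∩P with x∈p∩q⁻ H _ x∈H∩P
  ...   | x∈H , x∈P = x , x∈p∩q⁺ (x∈H , P⊆Q x∈P)

  IsCover-antimonoˡ : ∀ {F F′ : Family n} {S} → F′ ⊆ᴸ F → IsCover F S → IsCover F′ S
  IsCover-antimonoˡ F′⊆F covS H H∈F′ = covS H (F′⊆F H∈F′)

  isCover? : ∀ (F : Family n) S → Dec (IsCover F S)
  isCover? F S with All.all? (λ H → nonempty? (H ∩ S)) F
  ... | yes all = yes (λ H H∈F → All.lookup all H∈F)
  ... | no ¬all = no (λ covS → ¬all (All.tabulate (λ {H} → covS H)))

  irredundant⇒IsTransversal : ∀ {F : Family n} {S} → IsCover F S →
                              (∀ i → i ∈ S → ¬ IsCover F (S - i)) → IsTransversal F S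
  irredundant⇒IsTransversal {F} {S} covS irredundant = covS , minimal
    where
    minimal : ∀ S′ → S′ ⊆ S → IsCover F S′ → S′ ≡ S
    minimal S′ S′⊆S covS′ = ⊆-antisym S′⊆S S⊆S′
      where
      S⊆S′ : S ⊆ S′
      S⊆S′ {x} x∈S with x ∈? S′
      ... | yes x∈S′ = x∈S′
      ... | no  x∉S′ = contradiction (IsCover-monoʳ S′⊆S-x covS′) (irredundant x x∈S)
        where
        S′⊆S-x : S′ ⊆ S - x
        S′⊆S-x y∈S′ = x∈p∧x∉q⇒x∈p─q (S′⊆S y∈S′)
          (λ y∈⁅x⁆ → x∉S′ (subst (_∈ S′) (x∈⁅y⁆⇒x≡y _ y∈⁅x⁆) y∈S′))

  cover⇒⊇transversal : ∀ {F : Family n} {S} → IsCover F S →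
                       ∃ λ T → T ⊆ S × IsTransversal F T
  cover⇒⊇transversal {F} {S} = go S (<-wellFounded ∣ S ∣)
    where
    go : ∀ S → Acc _<_ ∣ S ∣ → IsCover F S → ∃ λ T → T ⊆ S × IsTransversal F T
    go S (acc smaller) covS with FinP.any? (λ i → i ∈? S ×-dec isCover? F (S - i))
    ... | no ¬removable =
      S , id , irredundant⇒IsTransversal covS (λ i i∈S covS-i → ¬removable (i , i∈S , covS-i))
    ... | yes (i , i∈S , covS-i) with go (S - i) (smaller (x∈p⇒∣p-x∣<∣p∣ i∈S)) covS-i
    ...   | T , T⊆S-i , trT = T , p─q⊆p S ⁅ i ⁆ ∘ T⊆S-i , trT

  bn≤∣cover∣ : ∀ {F : Family n} {k S} → IsBn F k → IsCover F S → k ≤ ∣ S ∣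
  bn≤∣cover∣ (_ , bn≤) covS with cover⇒⊇transversal covS
  ... | T , T⊆S , trT = ℕP.≤-trans (bn≤ T trT) (p⊆q⇒∣p∣≤∣q∣ T⊆S)

  minimumCover⇒IsBn : ∀ {F : Family n} {S} → IsCover F S →
                      (∀ S′ → IsCover F S′ → ∣ S ∣ ≤ ∣ S′ ∣) → IsBn F ∣ S ∣
  minimumCover⇒IsBn {F} {S} covS minimum =
    (S , (covS , minimal) , refl) , λ T trT → minimum T (proj₁ trT)
    where
    minimal : ∀ S′ → S′ ⊆ S → IsCover F S′ → S′ ≡ S
    minimal S′ S′⊆S covS′ = p⊆q∧∣q∣≤∣p∣⇒p≡q S′⊆S (minimum S′ covS′)

  IsMinb⇒∣B∣≡bn : ∀ {F : Family n} {k B} → IsBn F k → IsMinb F B → ∣ B ∣ ≡ k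
  IsMinb⇒∣B∣≡bn ((B₀ , trB₀ , ∣B₀∣≡k) , bn≤) (trB , minimum) =
    ℕP.≤-antisym (subst (_ ≤_) ∣B₀∣≡k (minimum B₀ trB₀)) (bn≤ _ trB)

  restrict-⊆ᴸ : ∀ {C D : Family n} E → D ⊆ᴸ C → restrict D E ⊆ᴸ restrict C E
  restrict-⊆ᴸ E = filter⁺′ (_⊆? E) (_⊆? E) id

  IsCover-restrict-∩ : ∀ {C : Family n} {B} E → IsCover C B → IsCover (restrict C E) (B ∩ E)
  IsCover-restrict-∩ {C} E covB H H∈C[E] with ∈-filter⁻ (_⊆? E) {xs = C} H∈C[E]
  ... | H∈C , H⊆E with covB H H∈C
  ...   | x , x∈H∩B with x∈p∩q⁻ H _ x∈H∩B
  ...     | x∈H , x∈B = x , x∈p∩q⁺ (x∈H , x∈p∩q⁺ (x∈B , H⊆E x∈H))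

  separable-⊆ᴸ : ∀ {C D : Family n} {k} → D ⊆ᴸ C → IsBn C k →
                 (∀ T → IsCover D T → k ≤ ∣ T ∣) → Separable D → Separable C
  separable-⊆ᴸ {C} {D} {k} D⊆C bnC@((B , (covB , _) , ∣B∣≡k) , _) bnC≤
    (E₁ , E₂ , bip , k′ , k₁ , k₂ , ((T , (covT , _) , ∣T∣≡k′) , _) , bn₁ , bn₂ , k′≡k₁+k₂) =
    E₁ , E₂ , bip , k , ∣ B ∩ E₁ ∣ , ∣ B ∩ E₂ ∣ ,
    bnC , IsBn-restrict E₁ bn₁ ∣B∩E₁∣≤k₁ , IsBn-restrict E₂ bn₂ ∣B∩E₂∣≤k₂ , sym ∣B∩E₁∣+∣B∩E₂∣≡k
    where
    ∣B∩E₁∣+∣B∩E₂∣≡k : ∣ B ∩ E₁ ∣ + ∣ B ∩ E₂ ∣ ≡ k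
    ∣B∩E₁∣+∣B∩E₂∣≡k = begin
      ∣ B ∩ E₁ ∣ + ∣ B ∩ E₂ ∣   ≡⟨ cong (λ E → ∣ B ∩ E₁ ∣ + ∣ B ∩ E ∣) (bipartition⇒≡∁ bip) ⟩
      ∣ B ∩ E₁ ∣ + ∣ B ∩ ∁ E₁ ∣ ≡⟨ ∣p∩q∣+∣p∩∁q∣≡∣p∣ B E₁ ⟩
      ∣ B ∣                     ≡⟨ ∣B∣≡k ⟩
      k                         ∎
      where open ≡-Reasoning

    covers-restrict-D : ∀ E {S} → IsCover (restrict C E) S → IsCover (restrict D E) S
    covers-restrict-D E = IsCover-antimonoˡ (restrict-⊆ᴸ E D⊆C)

    bnD[E]≤∣B∩E∣ : ∀ E {kᴱ} → IsBn (restrict D E) kᴱ → kᴱ ≤ ∣ B ∩ E ∣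
    bnD[E]≤∣B∩E∣ E bnᴱ = bn≤∣cover∣ bnᴱ (covers-restrict-D E (IsCover-restrict-∩ E covB))

    ∣B∩E∣≤k₁+k₂ : ∣ B ∩ E₁ ∣ + ∣ B ∩ E₂ ∣ ≤ k₁ + k₂
    ∣B∩E∣≤k₁+k₂ = subst₂ _≤_ (sym ∣B∩E₁∣+∣B∩E₂∣≡k) (trans ∣T∣≡k′ k′≡k₁+k₂) (bnC≤ T covT)

    ∣B∩E₁∣≤k₁ : ∣ B ∩ E₁ ∣ ≤ k₁
    ∣B∩E₁∣≤k₁ = ℕP.+-cancelʳ-≤ k₂ _ _
      (ℕP.≤-trans (ℕP.+-monoʳ-≤ ∣ B ∩ E₁ ∣ (bnD[E]≤∣B∩E∣ E₂ bn₂)) ∣B∩E∣≤k₁+k₂)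

    ∣B∩E₂∣≤k₂ : ∣ B ∩ E₂ ∣ ≤ k₂
    ∣B∩E₂∣≤k₂ = ℕP.+-cancelˡ-≤ k₁ _ _
      (ℕP.≤-trans (ℕP.+-monoˡ-≤ ∣ B ∩ E₂ ∣ (bnD[E]≤∣B∩E∣ E₁ bn₁)) ∣B∩E∣≤k₁+k₂)

    IsBn-restrict : ∀ E {kᴱ} → IsBn (restrict D E) kᴱ → ∣ B ∩ E ∣ ≤ kᴱ →
                    IsBn (restrict C E) ∣ B ∩ E ∣
    IsBn-restrict E bnᴱ ∣B∩E∣≤kᴱ = minimumCover⇒IsBn (IsCover-restrict-∩ E covB)
      (λ S covS → ℕP.≤-trans ∣B∩E∣≤kᴱ (bn≤∣cover∣ bnᴱ (covers-restrict-D E covS)))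

module _ {n : ℕ} {C : Family n} {y : Subset n → ℚ} (packing : IsFracPacking C y) where

  weighted-intersections≤ : ∀ S → sumℚ (map (λ H → ∣ H ∩ S ∣ · y H) C) ℚ.≤ fromℕ ∣ S ∣
  weighted-intersections≤ S = double-counting id y C S (λ {a} _ → proj₂ packing a)

  packingValue≤∣cover-of-support∣ : ∀ {S} → (∀ {H} → H ∈ᴸ C → 0ℚ ℚ.< y H → Nonempty (H ∩ S)) →
                                    packingValue C y ℚ.≤ fromℕ ∣ S ∣
  packingValue≤∣cover-of-support∣ {S} covS =
    ℚP.≤-trans (sum-mono-≤ C y≤∣H∩S∣·y) (weighted-intersections≤ S)
    where
    y≤∣H∩S∣·y : ∀ {H} → H ∈ᴸ C → y H ℚ.≤ ∣ H ∩ S ∣ · y H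
    y≤∣H∩S∣·y {H} H∈C with 0ℚ ℚP.<? y H
    ... | yes 0<yH = q≤m·q (nonempty⇒1≤∣p∣ (covS H∈C 0<yH)) (proj₁ packing H H∈C)
    ... | no  0≮yH = ℚP.≤-trans (ℚP.≮⇒≥ 0≮yH) (0≤m·q ∣ H ∩ S ∣ (proj₁ packing H H∈C))

  complementary-slackness : ∀ {S H} → IsCover C S → packingValue C y ≡ fromℕ ∣ S ∣ →
                            H ∈ᴸ C → 0ℚ ℚ.< y H → ∣ H ∩ S ∣ ≡ 1
  complementary-slackness {S} covS value≡∣S∣ H∈C 0<yH =
    m·q≤q⇒m≡1 (1≤∣H∩S∣ H∈C) 0<yH (sum-≤-tight C y≤∣H∩S∣·y weighted≤value H∈C)
    where
    1≤∣H∩S∣ : ∀ {H} → H ∈ᴸ C → 1 ≤ ∣ H ∩ S ∣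
    1≤∣H∩S∣ {H} H∈C = nonempty⇒1≤∣p∣ (covS H H∈C)
    y≤∣H∩S∣·y : ∀ {H} → H ∈ᴸ C → y H ℚ.≤ ∣ H ∩ S ∣ · y H
    y≤∣H∩S∣·y {H} H∈C = q≤m·q (1≤∣H∩S∣ H∈C) (proj₁ packing H H∈C)
    weighted≤value : sumℚ (map (λ H → ∣ H ∩ S ∣ · y H) C) ℚ.≤ packingValue C y
    weighted≤value = subst (sumℚ (map (λ H → ∣ H ∩ S ∣ · y H) C) ℚ.≤_) (sym value≡∣S∣)
                           (weighted-intersections≤ S)

lemma3p26 : ∀ (n : ℕ) (C D : Family n) → IsClutter C → MinTransversalCovered C
            → IntegralBlocking C → NonSeparable C → IsTilde C D → NonSeparable D
lemma3p26 n C D _ _ (k , bnC , (y , packing , value≡k) , _) nonSepC (_ , tilde) sepD =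
  nonSepC (separable-⊆ᴸ D⊆C bnC k≤∣cover-of-D∣ sepD)
  where
  D⊆C : D ⊆ᴸ C
  D⊆C {H} H∈D = proj₁ (proj₁ (tilde H) H∈D)

  support⊆D : ∀ {H} → H ∈ᴸ C → 0ℚ ℚ.< y H → H ∈ᴸ D
  support⊆D {H} H∈C 0<yH = proj₂ (tilde H) H∈C λ B minB →
    complementary-slackness packing (proj₁ (proj₁ minB))
      (trans value≡k (cong fromℕ (sym (IsMinb⇒∣B∣≡bn bnC minB)))) H∈C 0<yH

  k≤∣cover-of-D∣ : ∀ T → IsCover D T → k ≤ ∣ T ∣
  k≤∣cover-of-D∣ T covT = fromℕ-cancel-≤ (subst (ℚ._≤ fromℕ ∣ T ∣) value≡k
    (packingValue≤∣cover-of-support∣ packing (λ H∈C 0<yH → covT _ (support⊆D H∈C 0<yH))))
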